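{- Let $k$ and $n$ be positive integers. Then $$\sum_{l=0}^{n}(-1)^{\binom{l}{2k+1}}\left(1-(-1)^{\binom{l}{2k}}\right)\binom{n}{l}=\sum_{l=0}^{n-1}(-1)^{\binom{l}{2k}}\left(1-(-1)^{\binom{l}{2k-1}}\right)\binom{n-1}{l}.$$
   Context: Binomial coefficients $\binom{l}{a}$ are the usual ones, with $\binom{l}{a}=0$ when $a>l$. -}

module Defs where

open import Data.Nat as ℕ using (ℕ; zero; suc)
open import Data.Integer using (ℤ; +_; -_; _+_; _*_; _-_)

neg1^ : ℕ → ℤ
neg1^ zero    = + 1
neg1^ (suc m) = - (+ 1) * neg1^ m

sumTo : ℕ → (ℕ → ℤ) → ℤ
sumTo zero    f = f 0
sumTo (suc n) f = sumTo n f + f (suc n)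

-- Write σ_x l = (-1)^(l C x) and F l = σ_{2k+1} l (1 - σ_{2k} l). Pascal's rule turns the
-- left-hand sum into Σ_{l ≤ n-1} (F l + F (l+1)) C(n-1, l), and applying Pascal's rule once more
-- inside F (l+1) together with σ² = 1 gives F l + F (l+1) = σ_{2k+1} l (1 - σ_{2k-1} l).
-- It remains to replace σ_{2k+1} by σ_{2k} where l C (2k-1) is odd. Reading the absorption
-- identity (m+1) C(l,m+1) + m C(l,m) = l C(l,m) mod 2 shows that then l is odd, and that for
-- odd l and even m, C(l,m+1) and C(l,m) have the same parity.
module Submission where

open import Defs
open import Data.Nat using (ℕ; zero; suc; _+_; _*_; _∸_; _≤_)
open import Data.Nat.Combinatorics using (_C_; nC1≡n; nCk+nC[k+1]≡[n+1]C[k+1])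
open import Data.Nat.Combinatorics.Specification using (k>n⇒nCk≡0)
import Data.Nat.Properties as ℕ
import Data.Nat.Solver as ℕ-Solver
open import Data.Integer using (ℤ; +_; -_) renaming (_+_ to _+ℤ_; _*_ to _*ℤ_; _-_ to _-ℤ_)
import Data.Integer.Properties as ℤ
import Data.Integer.Solver as ℤ-Solver
open import Data.Product using (∃-syntax; _,_)
open import Data.Sum using (_⊎_; inj₁; inj₂)
open import Relation.Binary.PropositionalEquality
open ≡-Reasoning

C-absorption : ∀ l m → suc m * (l C suc m) + m * (l C m) ≡ l * (l C m)
C-absorption zero    zero    = refl
C-absorption zero    (suc m) = cong₂ _+_ (ℕ.*-zeroʳ (2 + m)) (ℕ.*-zeroʳ (1 + m))
C-absorption (suc l) zero    = begin
  1 * (suc l C 1) + 0   ≡⟨ ℕ.+-identityʳ _ ⟩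
  1 * (suc l C 1)       ≡⟨ ℕ.*-identityˡ _ ⟩
  suc l C 1             ≡⟨ nC1≡n (suc l) ⟩
  suc l                 ≡⟨ ℕ.*-identityʳ (suc l) ⟨
  suc l * 1             ∎
C-absorption (suc l) (suc m) = begin
  (2 + m) * (suc l C suc (suc m)) + (1 + m) * (suc l C suc m)
    ≡⟨ cong₂ (λ p q → (2 + m) * p + (1 + m) * q) (pascal (suc m)) (pascal m) ⟨
  (2 + m) * (y + z) + (1 + m) * (x + y)
    ≡⟨ solve 4 (λ x y z m → (con 2 :+ m) :* (y :+ z) :+ (con 1 :+ m) :* (x :+ y)
                 := ((con 2 :+ m) :* z :+ (con 1 :+ m) :* y) :+ ((con 1 :+ m) :* y :+ m :* x) :+ (x :+ y))
             refl x y z m ⟩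
  ((2 + m) * z + (1 + m) * y) + ((1 + m) * y + m * x) + (x + y)
    ≡⟨ cong₂ (λ p q → p + q + (x + y)) (C-absorption l (suc m)) (C-absorption l m) ⟩
  l * y + l * x + (x + y)
    ≡⟨ solve 3 (λ x y l → l :* y :+ l :* x :+ (x :+ y) := (con 1 :+ l) :* (x :+ y)) refl x y l ⟩
  suc l * (x + y)
    ≡⟨ cong (suc l *_) (pascal m) ⟩
  suc l * (suc l C suc m) ∎
  where
  open ℕ-Solver.+-*-Solver
  pascal = nCk+nC[k+1]≡[n+1]C[k+1] l
  x = l C m
  y = l C suc m
  z = l C suc (suc m)

neg1^-+ : ∀ m n → neg1^ (m + n) ≡ neg1^ m *ℤ neg1^ n
neg1^-+ zero    n = sym (ℤ.*-identityˡ (neg1^ n))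
neg1^-+ (suc m) n = begin
  - + 1 *ℤ neg1^ (m + n)           ≡⟨ cong (- + 1 *ℤ_) (neg1^-+ m n) ⟩
  - + 1 *ℤ (neg1^ m *ℤ neg1^ n)    ≡⟨ ℤ.*-assoc (- + 1) (neg1^ m) (neg1^ n) ⟨
  neg1^ (suc m) *ℤ neg1^ n         ∎

neg1^-double : ∀ n → neg1^ (n + n) ≡ + 1
neg1^-double zero    = refl
neg1^-double (suc n) = begin
  neg1^ (suc (n + suc n))              ≡⟨ cong (λ t → neg1^ (suc t)) (ℕ.+-suc n n) ⟩
  - + 1 *ℤ (- + 1 *ℤ neg1^ (n + n))    ≡⟨ cong (λ t → - + 1 *ℤ (- + 1 *ℤ t)) (neg1^-double n) ⟩
  + 1                                  ∎

neg1^-square : ∀ n → neg1^ n *ℤ neg1^ n ≡ + 1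
neg1^-square n = trans (sym (neg1^-+ n n)) (neg1^-double n)

neg1^-+-even-* : ∀ x n y → neg1^ (x + (n + n) * y) ≡ neg1^ x
neg1^-+-even-* x n y = begin
  neg1^ (x + (n + n) * y)              ≡⟨ neg1^-+ x _ ⟩
  neg1^ x *ℤ neg1^ ((n + n) * y)       ≡⟨ cong (λ t → neg1^ x *ℤ neg1^ t) (ℕ.*-distribʳ-+ y n n) ⟩
  neg1^ x *ℤ neg1^ (n * y + n * y)     ≡⟨ cong (neg1^ x *ℤ_) (neg1^-double (n * y)) ⟩
  neg1^ x *ℤ + 1                       ≡⟨ ℤ.*-identityʳ (neg1^ x) ⟩
  neg1^ x                              ∎

neg1^-even-* : ∀ n y → neg1^ ((n + n) * y) ≡ + 1
neg1^-even-* = neg1^-+-even-* 0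

neg1^-odd-* : ∀ n y → neg1^ (suc (n + n) * y) ≡ neg1^ y
neg1^-odd-* n y = neg1^-+-even-* y n y

neg1^[2jC1+2u]≡1 : ∀ j u → neg1^ ((j + j) C suc (u + u)) ≡ + 1
neg1^[2jC1+2u]≡1 j u = begin
  neg1^ a                                          ≡⟨ neg1^-odd-* u a ⟨
  neg1^ (suc (u + u) * a)                          ≡⟨ neg1^-+-even-* (suc (u + u) * a) (suc u) a' ⟨
  neg1^ (suc (u + u) * a + (suc u + suc u) * a')
    ≡⟨ cong neg1^ (trans (ℕ.+-comm (suc (u + u) * a) _)
                         (cong (λ t → suc t * a' + suc (u + u) * a) (ℕ.+-suc u u))) ⟩
  neg1^ (suc (suc (u + u)) * a' + suc (u + u) * a) ≡⟨ cong neg1^ (C-absorption (j + j) (suc (u + u))) ⟩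
  neg1^ ((j + j) * a)                              ≡⟨ neg1^-even-* j a ⟩
  + 1                                              ∎
  where
  a  = (j + j) C suc (u + u)
  a' = (j + j) C suc (suc (u + u))

neg1^[1+2jC1+2v]≡neg1^[1+2jC2v] : ∀ j v →
  neg1^ (suc (j + j) C suc (v + v)) ≡ neg1^ (suc (j + j) C (v + v))
neg1^[1+2jC1+2v]≡neg1^[1+2jC2v] j v = begin
  neg1^ c                                ≡⟨ neg1^-odd-* v c ⟨
  neg1^ (suc (v + v) * c)                ≡⟨ neg1^-+-even-* (suc (v + v) * c) v b ⟨
  neg1^ (suc (v + v) * c + (v + v) * b)  ≡⟨ cong neg1^ (C-absorption (suc (j + j)) (v + v)) ⟩
  neg1^ (suc (j + j) * b)                ≡⟨ neg1^-odd-* j b ⟩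
  neg1^ b                                ∎
  where
  b = suc (j + j) C (v + v)
  c = suc (j + j) C suc (v + v)

c[1-b]+bc[1-ab]≡c[1-a] : ∀ a b c → b *ℤ b ≡ + 1 →
  c *ℤ (+ 1 -ℤ b) +ℤ b *ℤ c *ℤ (+ 1 -ℤ a *ℤ b) ≡ c *ℤ (+ 1 -ℤ a)
c[1-b]+bc[1-ab]≡c[1-a] a b c b²≡1 = begin
  c *ℤ (+ 1 -ℤ b) +ℤ b *ℤ c *ℤ (+ 1 -ℤ a *ℤ b)
    ≡⟨ solve 3 (λ a b c → c :* (con (+ 1) :- b) :+ b :* c :* (con (+ 1) :- a :* b)
                  := c :* (con (+ 1) :- a) :+ c :* a :* (con (+ 1) :- b :* b)) refl a b c ⟩
  c *ℤ (+ 1 -ℤ a) +ℤ c *ℤ a *ℤ (+ 1 -ℤ b *ℤ b)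
    ≡⟨ cong (λ t → c *ℤ (+ 1 -ℤ a) +ℤ c *ℤ a *ℤ (+ 1 -ℤ t)) b²≡1 ⟩
  c *ℤ (+ 1 -ℤ a) +ℤ c *ℤ a *ℤ (+ 1 -ℤ + 1)
    ≡⟨ solve 2 (λ a c → c :* (con (+ 1) :- a) :+ c :* a :* (con (+ 1) :- con (+ 1))
                  := c :* (con (+ 1) :- a)) refl a c ⟩
  c *ℤ (+ 1 -ℤ a) ∎
  where open ℤ-Solver.+-*-Solver

even⊎odd : ∀ n → (∃[ j ] n ≡ j + j) ⊎ (∃[ j ] n ≡ suc (j + j))
even⊎odd zero    = inj₁ (0 , refl)
even⊎odd (suc n) with even⊎odd n
... | inj₁ (j , refl) = inj₂ (j , refl)
... | inj₂ (j , refl) = inj₁ (suc j , cong suc (sym (ℕ.+-suc j j)))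

neg1^-C-shift : ∀ u l → let a = suc (u + u) in
  neg1^ (l C suc (suc a)) *ℤ (+ 1 -ℤ neg1^ (l C a)) ≡ neg1^ (l C suc a) *ℤ (+ 1 -ℤ neg1^ (l C a))
neg1^-C-shift u l with even⊎odd l
... | inj₁ (j , refl) rewrite neg1^[2jC1+2u]≡1 j u =
  trans (ℤ.*-zeroʳ (neg1^ ((j + j) C suc (suc (suc (u + u))))))
        (sym (ℤ.*-zeroʳ (neg1^ ((j + j) C suc (suc (u + u))))))
... | inj₂ (j , refl) = cong (_*ℤ (+ 1 -ℤ neg1^ (suc (j + j) C suc (u + u)))) odd-case
  where
  odd-case : neg1^ (suc (j + j) C suc (suc (suc (u + u)))) ≡ neg1^ (suc (j + j) C suc (suc (u + u)))
  odd-case = subst (λ v → neg1^ (suc (j + j) C suc v) ≡ neg1^ (suc (j + j) C v))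
                   (cong suc (ℕ.+-suc u u)) (neg1^[1+2jC1+2v]≡neg1^[1+2jC2v] j (suc u))

sumTo-cong : ∀ n {f g : ℕ → ℤ} → (∀ l → f l ≡ g l) → sumTo n f ≡ sumTo n g
sumTo-cong zero    f≗g = f≗g 0
sumTo-cong (suc n) f≗g = cong₂ _+ℤ_ (sumTo-cong n f≗g) (f≗g (suc n))

sumTo-distrib-+ : ∀ n (f g : ℕ → ℤ) → sumTo n (λ l → f l +ℤ g l) ≡ sumTo n f +ℤ sumTo n g
sumTo-distrib-+ zero    f g = refl
sumTo-distrib-+ (suc n) f g = begin
  sumTo n (λ l → f l +ℤ g l) +ℤ (f (suc n) +ℤ g (suc n))
    ≡⟨ cong (_+ℤ (f (suc n) +ℤ g (suc n))) (sumTo-distrib-+ n f g) ⟩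
  sumTo n f +ℤ sumTo n g +ℤ (f (suc n) +ℤ g (suc n))
    ≡⟨ solve 4 (λ a b c d → a :+ b :+ (c :+ d) := a :+ c :+ (b :+ d)) refl
         (sumTo n f) (sumTo n g) (f (suc n)) (g (suc n)) ⟩
  sumTo n f +ℤ f (suc n) +ℤ (sumTo n g +ℤ g (suc n)) ∎
  where open ℤ-Solver.+-*-Solver

sumTo-suc : ∀ n (f : ℕ → ℤ) → sumTo (suc n) f ≡ f 0 +ℤ sumTo n (λ l → f (suc l))
sumTo-suc zero    f = refl
sumTo-suc (suc n) f = trans (cong (_+ℤ f (suc (suc n))) (sumTo-suc n f))
                            (ℤ.+-assoc (f 0) (sumTo n (λ l → f (suc l))) (f (suc (suc n))))

sumTo-pascal : ∀ n (F : ℕ → ℤ) →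
  sumTo (suc n) (λ l → F l *ℤ + (suc n C l)) ≡ sumTo n (λ l → (F l +ℤ F (suc l)) *ℤ + (n C l))
sumTo-pascal n F = begin
  sumTo (suc n) (λ l → F l *ℤ + (suc n C l))
    ≡⟨ sumTo-suc n _ ⟩
  F 0 *ℤ + 1 +ℤ sumTo n (λ l → F (suc l) *ℤ + (suc n C suc l))
    ≡⟨ cong (F 0 *ℤ + 1 +ℤ_) (sumTo-cong n split) ⟩
  F 0 *ℤ + 1 +ℤ sumTo n (λ l → F (suc l) *ℤ + (n C l) +ℤ F (suc l) *ℤ + (n C suc l))
    ≡⟨ cong (F 0 *ℤ + 1 +ℤ_) (sumTo-distrib-+ n _ _) ⟩
  F 0 *ℤ + 1 +ℤ (X +ℤ Y)
    ≡⟨ solve 3 (λ a x y → a :+ (x :+ y) := a :+ y :+ x) refl (F 0 *ℤ + 1) X Y ⟩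
  F 0 *ℤ + 1 +ℤ Y +ℤ X
    ≡⟨ cong (_+ℤ X) (sumTo-suc n G) ⟨
  sumTo (suc n) G +ℤ X
    ≡⟨ cong (_+ℤ X) top-term-vanishes ⟩
  sumTo n G +ℤ X
    ≡⟨ sumTo-distrib-+ n G _ ⟨
  sumTo n (λ l → F l *ℤ + (n C l) +ℤ F (suc l) *ℤ + (n C l))
    ≡⟨ sumTo-cong n (λ l → ℤ.*-distribʳ-+ (+ (n C l)) (F l) (F (suc l))) ⟨
  sumTo n (λ l → (F l +ℤ F (suc l)) *ℤ + (n C l)) ∎
  where
  open ℤ-Solver.+-*-Solver
  G = λ l → F l *ℤ + (n C l)
  X = sumTo n (λ l → F (suc l) *ℤ + (n C l))
  Y = sumTo n (λ l → F (suc l) *ℤ + (n C suc l))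
  split : ∀ l → F (suc l) *ℤ + (suc n C suc l) ≡ F (suc l) *ℤ + (n C l) +ℤ F (suc l) *ℤ + (n C suc l)
  split l = trans (cong (λ t → F (suc l) *ℤ + t) (sym (nCk+nC[k+1]≡[n+1]C[k+1] n l)))
                  (ℤ.*-distribˡ-+ (F (suc l)) (+ (n C l)) (+ (n C suc l)))
  top-term-vanishes : sumTo (suc n) G ≡ sumTo n G
  top-term-vanishes = begin
    sumTo n G +ℤ F (suc n) *ℤ + (n C suc n) ≡⟨ cong (λ t → sumTo n G +ℤ F (suc n) *ℤ + t) (k>n⇒nCk≡0 (ℕ.n<1+n n)) ⟩
    sumTo n G +ℤ F (suc n) *ℤ + 0           ≡⟨ cong (sumTo n G +ℤ_) (ℤ.*-zeroʳ (F (suc n))) ⟩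
    sumTo n G +ℤ + 0                        ≡⟨ ℤ.+-identityʳ (sumTo n G) ⟩
    sumTo n G                               ∎

parityBinomialSum : ℕ → ℕ → ℕ → ℤ
parityBinomialSum n c b = sumTo n (λ l → neg1^ (l C c) *ℤ (+ 1 -ℤ neg1^ (l C b)) *ℤ + (n C l))

parityBinomialSum-step : ∀ u n → let b = suc (suc (u + u)) in
  parityBinomialSum (suc n) (suc b) b ≡ parityBinomialSum n b (b ∸ 1)
parityBinomialSum-step u n =
  trans (sumTo-pascal n F) (sumTo-cong n (λ l → cong (_*ℤ + (n C l)) (F[l]+F[1+l] l)))
  where
  a = suc (u + u)
  b = suc a
  F : ℕ → ℤ
  F l = neg1^ (l C suc b) *ℤ (+ 1 -ℤ neg1^ (l C b))
  F[l]+F[1+l] : ∀ l → F l +ℤ F (suc l) ≡ neg1^ (l C b) *ℤ (+ 1 -ℤ neg1^ (l C a))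
  F[l]+F[1+l] l = begin
    F l +ℤ neg1^ (suc l C suc b) *ℤ (+ 1 -ℤ neg1^ (suc l C suc a))
      ≡⟨ cong₂ (λ p q → F l +ℤ neg1^ p *ℤ (+ 1 -ℤ neg1^ q))
               (sym (nCk+nC[k+1]≡[n+1]C[k+1] l b)) (sym (nCk+nC[k+1]≡[n+1]C[k+1] l a)) ⟩
    F l +ℤ neg1^ (l C b + l C suc b) *ℤ (+ 1 -ℤ neg1^ (l C a + l C b))
      ≡⟨ cong₂ (λ p q → F l +ℤ p *ℤ (+ 1 -ℤ q)) (neg1^-+ (l C b) (l C suc b)) (neg1^-+ (l C a) (l C b)) ⟩
    F l +ℤ sb *ℤ sc *ℤ (+ 1 -ℤ sa *ℤ sb)
      ≡⟨ c[1-b]+bc[1-ab]≡c[1-a] sa sb sc (neg1^-square (l C b)) ⟩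
    sc *ℤ (+ 1 -ℤ sa)
      ≡⟨ neg1^-C-shift u l ⟩
    sb *ℤ (+ 1 -ℤ sa) ∎
    where
    sa = neg1^ (l C a)
    sb = neg1^ (l C b)
    sc = neg1^ (l C suc b)

2+[k+k]≡2*[1+k] : ∀ k → suc (suc (k + k)) ≡ 2 * suc k
2+[k+k]≡2*[1+k] k = cong suc (sym (trans (ℕ.+-suc k (k + 0)) (cong (λ t → suc (k + t)) (ℕ.+-identityʳ k))))

corollary3p3 : (k n : ℕ) → 1 ≤ k → 1 ≤ n →
    sumTo n (λ l → neg1^ (l C (2 * k + 1)) *ℤ ((+ 1) -ℤ neg1^ (l C (2 * k))) *ℤ (+ (n C l)))
      ≡ sumTo (n ∸ 1) (λ l → neg1^ (l C (2 * k)) *ℤ ((+ 1) -ℤ neg1^ (l C (2 * k ∸ 1))) *ℤ (+ ((n ∸ 1) C l)))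
corollary3p3 (suc k) (suc n) _ _ =
  subst₂ (λ c b → parityBinomialSum (suc n) c b ≡ parityBinomialSum n b (b ∸ 1))
         (trans (cong suc b≡2k) (ℕ.+-comm 1 (2 * suc k))) b≡2k
         (parityBinomialSum-step k n)
  where b≡2k = 2+[k+k]≡2*[1+k] k
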